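{- Let $k\ge1$ and let $(c_1,\dots,c_k)$ and $(m_1,\dots,m_k)$ be a consistent pair of sequences, with $n=c_1+\dots+c_k$. Then the output $\pi$ of the stack procedure described in the context, run on this input, avoids the classical pattern $231$.
   Context: A pair of sequences of positive integers $(c_1,\dots,c_k)$ and $(m_1,\dots,m_k)$ is consistent if: $c_1\ge 2$; $c_1+\dots+c_k=n$; $n=m_1>m_2>\dots>m_k$; and $m_i>c_i+c_{i+1}+\dots+c_k$ for all $1<i\le k$. The stack procedure: let $M=\{m_2,\dots,m_k\}$; start with two empty stacks $\mathscr{A},\mathscr{B}$ and a counter $p:=n$. For $i=1,2,\dots,k$ in order: (Step 1) repeat $c_i$ times: push $p$ onto $\mathscr{A}$ and decrease $p$ by $1$; (Step 2) while $\mathscr{A}$ is nonempty and the top of $\mathscr{A}$ is not in $M$, pop the top of $\mathscr{A}$ and push it onto $\mathscr{B}$; (Step 3) if $\mathscr{A}$ is nonempty, pop the top of $\mathscr{A}$ and push it onto $\mathscr{B}$. The output $\pi$ is the word obtained by reading $\mathscr{B}$ from top to bottom ($\pi_1$ is the top). A sequence $\pi_1\cdots\pi_n$ of distinct integers avoids the classical pattern $231$ if there are no indices $a<b<c$ with $\pi_c<\pi_a<\pi_b$. -}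

module Defs where

open import Data.Nat using (ℕ; zero; suc; _+_; _∸_; _≤_; _<_; _≡ᵇ_)
open import Data.Bool using (Bool; true; false; if_then_else_)
open import Data.List using (List; []; _∷_; length; lookup)
open import Data.Nat.ListAction using (sum)
open import Data.Bool.ListAction using (any)
open import Data.List.Relation.Unary.All using (All)
open import Data.List.Relation.Unary.Linked using (Linked)
open import Data.Product using (_×_; _,_; proj₁; proj₂)
open import Data.Unit using (⊤)
open import Data.Empty using (⊥)
open import Data.Fin using (Fin) renaming (_<_ to _<ᶠ_)
open import Relation.Nullary using (¬_)
open import Relation.Binary.PropositionalEquality using (_≡_)

-- Stacks are lists, head = top of the stack.

TailCond : List ℕ → List ℕ → Set
TailCond []       []       = ⊤
TailCond (c ∷ cs) (m ∷ ms) = sum (c ∷ cs) < m × TailCond cs ms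
TailCond []       (_ ∷ _)  = ⊥
TailCond (_ ∷ _)  []       = ⊥

Consistent : ℕ → List ℕ → List ℕ → Set
Consistent n []        _         = ⊥
Consistent n (_ ∷ _)   []        = ⊥
Consistent n (c₁ ∷ cs) (m₁ ∷ ms) =
  All (1 ≤_) (c₁ ∷ cs) × All (1 ≤_) (m₁ ∷ ms) ×
  length cs ≡ length ms ×
  2 ≤ c₁ ×
  c₁ + sum cs ≡ n ×
  m₁ ≡ n ×
  Linked (λ x y → y < x) (m₁ ∷ ms) ×
  TailCond cs ms

inM : List ℕ → ℕ → Bool
inM M x = any (λ y → y ≡ᵇ x) M

pushN : ℕ → ℕ → List ℕ → ℕ × List ℕ
pushN zero    p A = p , A
pushN (suc c) p A = pushN c (p ∸ 1) (p ∷ A)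

step2 : List ℕ → List ℕ → List ℕ → List ℕ × List ℕ
step2 M []      B = [] , B
step2 M (x ∷ A) B = if inM M x then (x ∷ A , B) else step2 M A (x ∷ B)

step3 : List ℕ × List ℕ → List ℕ × List ℕ
step3 ([]    , B) = [] , B
step3 (x ∷ A , B) = A , x ∷ B

runLoop : List ℕ → List ℕ → ℕ → List ℕ → List ℕ → List ℕ
runLoop M []       p A B = B
runLoop M (c ∷ cs) p A B =
  let r  = pushN c p A
      st = step3 (step2 M (proj₂ r) B)
  in runLoop M cs (proj₁ r) (proj₁ st) (proj₂ st)

-- The stack procedure with M = {m_2,...,m_k}, p := n; output is B read
-- from top to bottom (head of the list = π_1).
stackProc : ℕ → List ℕ → List ℕ → List ℕ
stackProc n c []        = runLoop [] c n [] []
stackProc n c (_ ∷ ms)  = runLoop ms c n [] []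

Avoids231 : List ℕ → Set
Avoids231 π = (a b c : Fin (length π)) → a <ᶠ b → b <ᶠ c →
  ¬ (lookup π c < lookup π a × lookup π a < lookup π b)

{-# OPTIONS --safe #-}
-- The counter p only decreases, so every value pushed onto 𝒜 is smaller than all
-- values already on either stack, and 𝒜 is increasing from its top. Hence, while
-- x waits on 𝒜, only values smaller than x are moved onto ℬ, and they land to the
-- left of x in π; every value to the right of x in π was on ℬ before x was pushed
-- and so exceeds x. No 231 pattern can start at x. The argument never uses that
-- the pair is consistent: the conclusion holds for every M and every (c_i).
module Submission where

open import Defs
open import Data.Nat using (ℕ; zero; suc; _≤_; _<_; _∸_; s≤s)
open import Data.Nat.Properties using (≤-trans; m∸n≤m; ≤⇒≯)
open import Data.List using (List; []; _∷_; length; lookup)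
open import Data.List.Relation.Unary.All as All using (All; []; _∷_)
open import Data.List.Relation.Unary.AllPairs using (AllPairs; []; _∷_)
open import Data.List.Membership.Propositional.Properties using (∈-lookup)
open import Data.Product using (_×_; _,_; proj₁; proj₂)
open import Data.Unit using (⊤; tt)
open import Data.Empty using (⊥-elim)
open import Data.Bool using (true; false)
open import Data.Fin using (Fin) renaming (zero to fzero; suc to fsuc; _<_ to _<ᶠ_)
open import Relation.Nullary using (¬_)

No231From : ℕ → List ℕ → Set
No231From x []      = ⊤
No231From x (y ∷ B) = (x < y → All (x ≤_) B) × No231From x B

231-Free : List ℕ → Set
231-Free []      = ⊤
231-Free (x ∷ B) = No231From x B × 231-Free B

lookup-All : ∀ {P : ℕ → Set} {L : List ℕ} → All P L → (i : Fin (length L)) → P (lookup L i)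
lookup-All ps i = All.lookup ps (∈-lookup i)

No231From⇒¬pattern : ∀ x (B : List ℕ) → No231From x B → (b c : Fin (length B)) → b <ᶠ c →
  ¬ (lookup B c < x × x < lookup B b)
No231From⇒¬pattern x (y ∷ B) (x<y⇒B≥x , _) fzero (fsuc c) _ (c<x , x<y) =
  ≤⇒≯ (lookup-All (x<y⇒B≥x x<y) c) c<x
No231From⇒¬pattern x (y ∷ B) (_ , rest) (fsuc b) (fsuc c) (s≤s b<c) =
  No231From⇒¬pattern x B rest b c b<c

231-Free⇒Avoids231 : (π : List ℕ) → 231-Free π → Avoids231 π
231-Free⇒Avoids231 (x ∷ π) (head , _) fzero (fsuc b) (fsuc c) _ (s≤s b<c) =
  No231From⇒¬pattern x π head b c b<c
231-Free⇒Avoids231 (x ∷ π) (_ , tail) (fsuc a) (fsuc b) (fsuc c) (s≤s a<b) (s≤s b<c) =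
  231-Free⇒Avoids231 π tail a b c a<b b<c

No231From-lower : ∀ {x} (B : List ℕ) → All (x ≤_) B → No231From x B
No231From-lower []      []           = tt
No231From-lower (y ∷ B) (_ ∷ x≤B) = (λ _ → x≤B) , No231From-lower B x≤B

No231From-cons-lower : ∀ {x y} B → x ≤ y → No231From y B → No231From y (x ∷ B)
No231From-cons-lower B x≤y h = (λ y<x → ⊥-elim (≤⇒≯ x≤y y<x)) , h

record Invariant (p : ℕ) (A B : List ℕ) : Set where
  field
    A-increasing : AllPairs _≤_ A
    A-above      : All (p ≤_) A
    B-above      : All (p ≤_) B
    A-no231      : All (λ y → No231From y B) A
    B-free       : 231-Free B

open Invariant

initial : ∀ p → Invariant p [] []
initial p = record
  { A-increasing = [] ; A-above = [] ; B-above = [] ; A-no231 = [] ; B-free = tt }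

push-preserves : ∀ {p A B} → Invariant p A B → Invariant (p ∸ 1) (p ∷ A) B
push-preserves {p} {A} {B} inv = record
  { A-increasing = A-above inv ∷ A-increasing inv
  ; A-above      = m∸n≤m p 1 ∷ All.map (≤-trans (m∸n≤m p 1)) (A-above inv)
  ; B-above      = All.map (≤-trans (m∸n≤m p 1)) (B-above inv)
  ; A-no231      = No231From-lower B (B-above inv) ∷ A-no231 inv
  ; B-free       = B-free inv
  }

move-preserves : ∀ {p x A B} → Invariant p (x ∷ A) B → Invariant p A (x ∷ B)
move-preserves {B = B} inv with A-increasing inv | A-above inv | A-no231 inv
... | x≤A ∷ A↑ | p≤x ∷ p≤A | x-ok ∷ A-ok = record
  { A-increasing = A↑
  ; A-above      = p≤A
  ; B-above      = p≤x ∷ B-above inv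
  ; A-no231      = All.zipWith (λ (x≤y , y-ok) → No231From-cons-lower B x≤y y-ok) (x≤A , A-ok)
  ; B-free       = x-ok , B-free inv
  }

pushN-preserves : ∀ c {p A B} → Invariant p A B →
  Invariant (proj₁ (pushN c p A)) (proj₂ (pushN c p A)) B
pushN-preserves zero    inv = inv
pushN-preserves (suc c) inv = pushN-preserves c (push-preserves inv)

step2-preserves : ∀ M {p} A B → Invariant p A B →
  Invariant p (proj₁ (step2 M A B)) (proj₂ (step2 M A B))
step2-preserves M []      B inv = inv
step2-preserves M (x ∷ A) B inv with inM M x
... | true  = inv
... | false = step2-preserves M A (x ∷ B) (move-preserves inv)

step3-preserves : ∀ {p} A B → Invariant p A B →
  Invariant p (proj₁ (step3 (A , B))) (proj₂ (step3 (A , B)))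
step3-preserves []      B inv = inv
step3-preserves (x ∷ A) B inv = move-preserves inv

runLoop-231-Free : ∀ M cs {p} A B → Invariant p A B → 231-Free (runLoop M cs p A B)
runLoop-231-Free M []       A B inv = B-free inv
runLoop-231-Free M (c ∷ cs) {p} A B inv =
  runLoop-231-Free M cs (proj₁ after3) (proj₂ after3)
    (step3-preserves (proj₁ after2) (proj₂ after2)
      (step2-preserves M (proj₂ after1) B (pushN-preserves c inv)))
  where
  after1 : ℕ × List ℕ
  after1 = pushN c p A
  after2 : List ℕ × List ℕ
  after2 = step2 M (proj₂ after1) B
  after3 : List ℕ × List ℕ
  after3 = step3 after2

lemma3p12 : (n : ℕ) (c m : List ℕ) → Consistent n c m → Avoids231 (stackProc n c m)
lemma3p12 n c []       _ = 231-Free⇒Avoids231 _ (runLoop-231-Free [] c [] [] (initial n))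
lemma3p12 n c (_ ∷ ms) _ = 231-Free⇒Avoids231 _ (runLoop-231-Free ms c [] [] (initial n))
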